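{- Let $F$ be a $k$-vertex graph, $v \in V(F)$, $t$ a positive integer, and let $H$ be the graph obtained from $F$ by adding $t-1$ new copies of $v$ (new vertices, pairwise non-adjacent, each adjacent exactly to the neighbors of $v$ in $F$). For every $n$-vertex graph $G$, if the number of ordered copies of $F$ in $G$ is $x \cdot n^{k-1}$ with $x \ge 4t$, then the number of ordered copies of $H$ in $G$ is at least $\frac{1}{2^t} x^t n^{k-1}$.
   Context: An ordered copy of a graph $F$ with vertex set $\{v_1,\ldots,v_k\}$ in $G$ is an injective map $\phi: V(F)\to V(G)$ such that $\phi(v_i)\phi(v_j)\in E(G)$ whenever $v_iv_j\in E(F)$. -}

module Defs where

open import Data.Nat using (ℕ; zero; suc; _+_)
open import Data.Bool using (Bool; true; false; T; T?)
open import Data.Fin using (Fin; splitAt; _≟_)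
open import Data.Fin.Properties using (all?)
open import Data.Sum using (inj₁; inj₂)
open import Data.Product using (_×_)
open import Data.List using (List; []; _∷_; [_]; concatMap; map; filter; length; allFin)
open import Data.Vec using (Vec; lookup) renaming ([] to []ᵥ; _∷_ to _∷ᵥ_)
open import Relation.Nullary using (Dec)
open import Relation.Nullary.Decidable using (_→-dec_; _×-dec_)
open import Relation.Binary.PropositionalEquality using (_≡_)

record Graph (n : ℕ) : Set where
  field
    adj   : Fin n → Fin n → Bool
    sym   : ∀ i j → adj i j ≡ adj j i
    loopless : ∀ i → adj i i ≡ false
open Graph public

IsOrderedCopy : ∀ {k n} → Graph k → Graph n → Vec (Fin n) k → Set
IsOrderedCopy F G φ =
  (∀ i j → lookup φ i ≡ lookup φ j → i ≡ j) ×
  (∀ i j → T (adj F i j) → T (adj G (lookup φ i) (lookup φ j)))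

isOrderedCopy? : ∀ {k n} (F : Graph k) (G : Graph n) (φ : Vec (Fin n) k) →
                 Dec (IsOrderedCopy F G φ)
isOrderedCopy? F G φ =
  all? (λ i → all? (λ j → (lookup φ i ≟ lookup φ j) →-dec (i ≟ j)))
  ×-dec
  all? (λ i → all? (λ j → T? (adj F i j) →-dec T? (adj G (lookup φ i) (lookup φ j))))

allMaps : (k n : ℕ) → List (Vec (Fin n) k)
allMaps zero    n = [ []ᵥ ]
allMaps (suc k) n = concatMap (λ i → map (i ∷ᵥ_) (allMaps k n)) (allFin n)

numCopies : ∀ {k n} → Graph k → Graph n → ℕ
numCopies {k} {n} F G = length (filter (isOrderedCopy? F G) (allMaps k n))

-- Blow-up: H is obtained from F (on Fin k) by adding t' = t - 1 new copies
-- of v.  Vertices of H: Fin (k + t'); the first k are the vertices of F,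
-- the last t' are the new copies of v.
blowAdj : ∀ {k} (F : Graph k) (v : Fin k) (t' : ℕ) → Fin (k + t') → Fin (k + t') → Bool
blowAdj {k} F v t' i j with splitAt k i | splitAt k j
... | inj₁ a | inj₁ b = adj F a b
... | inj₁ a | inj₂ _ = adj F a v
... | inj₂ _ | inj₁ b = adj F v b
... | inj₂ _ | inj₂ _ = false

blowSym : ∀ {k} (F : Graph k) (v : Fin k) (t' : ℕ) i j → blowAdj F v t' i j ≡ blowAdj F v t' j i
blowSym {k} F v t' i j with splitAt k i | splitAt k j
... | inj₁ a | inj₁ b = sym F a b
... | inj₁ a | inj₂ _ = sym F a v
... | inj₂ _ | inj₁ b = sym F v b
... | inj₂ _ | inj₂ _ = Relation.Binary.PropositionalEquality.refl

blowLoopless : ∀ {k} (F : Graph k) (v : Fin k) (t' : ℕ) i → blowAdj F v t' i i ≡ false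
blowLoopless {k} F v t' i with splitAt k i
... | inj₁ a = loopless F a
... | inj₂ _ = Relation.Binary.PropositionalEquality.refl

blowUp : ∀ {k} (F : Graph k) (v : Fin k) (t' : ℕ) → Graph (k + t')
blowUp F v t' = record { adj = blowAdj F v t' ; sym = blowSym F v t' ; loopless = blowLoopless F v t' }

-- Fix the images ψ of the vertices of F other than v, and let d(ψ) be the number of vertices w
-- such that ψ extends to a copy of F by sending v to w, so that c = Σ_ψ d(ψ) counts the copies
-- of F. Any t distinct such w together with ψ form a copy of H, and there are at least
-- (d(ψ) − t + 1)^t such ordered t-tuples. Since c ≥ 4t·n^(k−1), truncating by t − 1 loses at most
-- c/2 over the n^(k−1) choices of ψ, and the power mean inequality
-- (Σ a)^t ≤ N^(t−1) Σ a^t over N = n^(k−1) terms finishes the count.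
module Submission where

open import Data.Bool using (Bool; true; false; T; not; _∧_; _∨_)
open import Data.Bool.Properties using (∧-assoc; T-∧; T-∨; T-not-≡)
open import Data.Empty using (⊥-elim)
open import Data.Fin using (Fin; zero; suc; _≟_; splitAt; join; punchOut)
open import Data.Fin.Properties using (join-splitAt; punchIn-punchOut; suc-injective; 0≢1+n)
open import Data.List as List using (List; []; _∷_; map; concatMap; filter; length; allFin)
open import Data.List.Properties using (map-tabulate; length-tabulate)
open import Data.Nat using (ℕ; zero; suc; _+_; _*_; _^_; _∸_; _≤_; z≤n; s≤s)
open import Data.Nat.Properties hiding (_≟_; 0≢1+n; suc-injective)
open import Algebra.Properties.CommutativeSemigroup +-commutativeSemigroup
  using () renaming (interchange to +-interchange)
open import Algebra.Properties.CommutativeSemigroup *-commutativeSemigroup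
  using () renaming (x∙yz≈y∙xz to x*[y*z]≡y*[x*z])
open import Data.Nat.Tactic.RingSolver using (solve-∀)
open import Data.Product using (_×_; _,_; proj₁; proj₂)
open import Data.Sum using (inj₁; inj₂; [_,_]′)
open import Data.Vec using (Vec; []; _∷_; lookup; insertAt; _++_)
open import Data.Vec.Properties using (lookup-splitAt; insertAt-lookup; insertAt-punchIn)
open import Function using (_∘_; id; Equivalence)
open import Level using (Level)
open import Relation.Binary.PropositionalEquality
open import Relation.Nullary using (Dec; yes; no; does; ¬_)
open import Relation.Nullary.Decidable using (dec-true)
open import Relation.Unary using (Decidable)

open import Defs hiding (sym)

private
  variable
    a b c p : Level
    A : Set a
    B : Set b
    C : Set c

𝟙 : Bool → ℕ
𝟙 true  = 1
𝟙 false = 0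

𝟙-mono : ∀ {x y} → (T x → T y) → 𝟙 x ≤ 𝟙 y
𝟙-mono {false}         _   = z≤n
𝟙-mono {true}  {true}  _   = ≤-refl
𝟙-mono {true}  {false} x⇒y = ⊥-elim (x⇒y _)

𝟙-∧ : ∀ x y → 𝟙 (x ∧ y) ≡ 𝟙 x * 𝟙 y
𝟙-∧ false y = refl
𝟙-∧ true  y = sym (+-identityʳ (𝟙 y))

𝟙-∨-≤ : ∀ x y → 𝟙 (x ∨ y) ≤ 𝟙 x + 𝟙 y
𝟙-∨-≤ false y = ≤-refl
𝟙-∨-≤ true  y = s≤s z≤n

𝟙-≤-∧-not : ∀ x y → 𝟙 x ≤ 𝟙 (x ∧ not y) + 𝟙 y
𝟙-≤-∧-not false y     = z≤n
𝟙-≤-∧-not true  false = ≤-refl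
𝟙-≤-∧-not true  true  = ≤-refl

-- toWitness and fromWitness are phrased with isYes, which is not definitionally does.
from-T-does : (a? : Dec A) → T (does a?) → A
from-T-does (yes a) _ = a

to-T-does : (a? : Dec A) → A → T (does a?)
to-T-does (yes _) _ = _
to-T-does (no ¬a) a = ¬a a

∑ : List A → (A → ℕ) → ℕ
∑ []       f = 0
∑ (x ∷ xs) f = f x + ∑ xs f

infixl 10 ∑
syntax ∑ xs (λ x → e) = ∑[ x ∈ xs ] e

∑-cong : ∀ (xs : List A) {f g : A → ℕ} → (∀ x → f x ≡ g x) → ∑ xs f ≡ ∑ xs g
∑-cong []       f≗g = refl
∑-cong (x ∷ xs) f≗g = cong₂ _+_ (f≗g x) (∑-cong xs f≗g)

∑-mono-≤ : ∀ (xs : List A) {f g : A → ℕ} → (∀ x → f x ≤ g x) → ∑ xs f ≤ ∑ xs g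
∑-mono-≤ []       f≤g = z≤n
∑-mono-≤ (x ∷ xs) f≤g = +-mono-≤ (f≤g x) (∑-mono-≤ xs f≤g)

∑-distrib-+ : ∀ (xs : List A) (f g : A → ℕ) → ∑[ x ∈ xs ] (f x + g x) ≡ ∑ xs f + ∑ xs g
∑-distrib-+ []       f g = refl
∑-distrib-+ (x ∷ xs) f g = begin
  (f x + g x) + ∑[ y ∈ xs ] (f y + g y)  ≡⟨ cong ((f x + g x) +_) (∑-distrib-+ xs f g) ⟩
  (f x + g x) + (∑ xs f + ∑ xs g)        ≡⟨ +-interchange (f x) (g x) _ _ ⟩
  (f x + ∑ xs f) + (g x + ∑ xs g)        ∎
  where open ≡-Reasoning

*-distribˡ-∑ : ∀ (c : ℕ) (xs : List A) (f : A → ℕ) → c * ∑ xs f ≡ ∑[ x ∈ xs ] (c * f x)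
*-distribˡ-∑ c []       f = *-zeroʳ c
*-distribˡ-∑ c (x ∷ xs) f = trans (*-distribˡ-+ c (f x) _) (cong (c * f x +_) (*-distribˡ-∑ c xs f))

*-distribʳ-∑ : ∀ (c : ℕ) (xs : List A) (f : A → ℕ) → ∑ xs f * c ≡ ∑[ x ∈ xs ] (f x * c)
*-distribʳ-∑ c []       f = refl
*-distribʳ-∑ c (x ∷ xs) f = trans (*-distribʳ-+ c (f x) _) (cong (f x * c +_) (*-distribʳ-∑ c xs f))

∑-const : ∀ (xs : List A) (c : ℕ) → ∑[ x ∈ xs ] c ≡ length xs * c
∑-const []       c = refl
∑-const (x ∷ xs) c = cong (c +_) (∑-const xs c)

length≡∑1 : (xs : List A) → length xs ≡ ∑[ x ∈ xs ] 1
length≡∑1 xs = sym (trans (∑-const xs 1) (*-identityʳ (length xs)))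

∑-zero : (xs : List A) → ∑[ x ∈ xs ] 0 ≡ 0
∑-zero xs = trans (∑-const xs 0) (*-zeroʳ (length xs))

∑-comm : ∀ (xs : List A) (ys : List B) (f : A → B → ℕ) →
         ∑[ x ∈ xs ] ∑[ y ∈ ys ] f x y ≡ ∑[ y ∈ ys ] ∑[ x ∈ xs ] f x y
∑-comm []       ys f = sym (∑-zero ys)
∑-comm (x ∷ xs) ys f =
  trans (cong (∑ ys (f x) +_) (∑-comm xs ys f)) (sym (∑-distrib-+ ys (f x) _))

∑-++ : ∀ (xs ys : List A) (f : A → ℕ) → ∑ (xs List.++ ys) f ≡ ∑ xs f + ∑ ys f
∑-++ []       ys f = refl
∑-++ (x ∷ xs) ys f = trans (cong (f x +_) (∑-++ xs ys f)) (sym (+-assoc (f x) _ _))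

∑-map : ∀ (g : A → B) (xs : List A) (f : B → ℕ) → ∑ (map g xs) f ≡ ∑ xs (f ∘ g)
∑-map g []       f = refl
∑-map g (x ∷ xs) f = cong (f (g x) +_) (∑-map g xs f)

∑-concatMap : ∀ (g : A → List B) (xs : List A) (f : B → ℕ) →
              ∑ (concatMap g xs) f ≡ ∑[ x ∈ xs ] ∑ (g x) f
∑-concatMap g []       f = refl
∑-concatMap g (x ∷ xs) f =
  trans (∑-++ (g x) (concatMap g xs) f) (cong (∑ (g x) f +_) (∑-concatMap g xs f))

length-filter : ∀ {P : A → Set p} (P? : Decidable P) (xs : List A) →
                length (filter P? xs) ≡ ∑[ x ∈ xs ] 𝟙 (does (P? x))
length-filter P? []       = refl
length-filter P? (x ∷ xs) with does (P? x)
... | true  = cong suc (length-filter P? xs)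
... | false = length-filter P? xs

∑∑-product : ∀ (xs : List A) (ys : List B) (f : A → ℕ) (g : B → ℕ) →
             ∑[ x ∈ xs ] ∑[ y ∈ ys ] (f x * g y) ≡ ∑ xs f * ∑ ys g
∑∑-product xs ys f g = begin
  ∑[ x ∈ xs ] ∑[ y ∈ ys ] (f x * g y)  ≡⟨ ∑-cong xs (λ x → sym (*-distribˡ-∑ (f x) ys g)) ⟩
  ∑[ x ∈ xs ] (f x * ∑ ys g)          ≡⟨ sym (*-distribʳ-∑ (∑ ys g) xs f) ⟩
  ∑ xs f * ∑ ys g                    ∎
  where open ≡-Reasoning

∑∑-symmetrise : ∀ (xs : List A) (f : A → A → ℕ) →
                ∑[ x ∈ xs ] ∑[ y ∈ xs ] (f x y + f y x) ≡ 2 * ∑[ x ∈ xs ] ∑[ y ∈ xs ] f x y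
∑∑-symmetrise xs f = begin
  ∑[ x ∈ xs ] ∑[ y ∈ xs ] (f x y + f y x)
    ≡⟨ ∑-cong xs (λ x → ∑-distrib-+ xs (f x) (λ y → f y x)) ⟩
  ∑[ x ∈ xs ] (∑[ y ∈ xs ] f x y + ∑[ y ∈ xs ] f y x)
    ≡⟨ ∑-distrib-+ xs _ _ ⟩
  D + ∑[ x ∈ xs ] ∑[ y ∈ xs ] f y x
    ≡⟨ cong (D +_) (∑-comm xs xs (λ x y → f y x)) ⟩
  D + D
    ≡⟨ cong (D +_) (sym (+-identityʳ D)) ⟩
  2 * D
    ∎
  where
  open ≡-Reasoning
  D : ℕ
  D = ∑[ x ∈ xs ] ∑[ y ∈ xs ] f x y

pow-rearrangement-≤ : ∀ {x y} m → x ≤ y → x * y ^ m + y * x ^ m ≤ x * x ^ m + y * y ^ m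
pow-rearrangement-≤ {x} m x≤y with m≤n⇒∃[o]m+o≡n x≤y | m≤n⇒∃[o]m+o≡n (^-monoˡ-≤ m x≤y)
... | e , refl | f , xᵐ+f≡yᵐ rewrite sym xᵐ+f≡yᵐ =
  subst (x * (x ^ m + f) + (x + e) * x ^ m ≤_) (gap x e (x ^ m) f) (m≤m+n _ (e * f))
  where
  gap : ∀ x e X f → x * (X + f) + (x + e) * X + e * f ≡ x * X + (x + e) * (X + f)
  gap = solve-∀

-- (x - y)(xᵐ - yᵐ) ≥ 0, written without subtraction.
pow-rearrangement : ∀ x y m → x * y ^ m + y * x ^ m ≤ x * x ^ m + y * y ^ m
pow-rearrangement x y m with ≤-total x y
... | inj₁ x≤y = pow-rearrangement-≤ m x≤y
... | inj₂ y≤x = subst₂ _≤_ (+-comm (y * x ^ m) _) (+-comm (y * y ^ m) _) (pow-rearrangement-≤ m y≤x)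

chebyshev : ∀ (xs : List A) (a : A → ℕ) m →
            ∑ xs a * ∑[ x ∈ xs ] (a x ^ m) ≤ length xs * ∑[ x ∈ xs ] (a x ^ suc m)
chebyshev xs a m = *-cancelˡ-≤ 2 (begin
  2 * (∑ xs a * ∑[ x ∈ xs ] (a x ^ m))
    ≡⟨ cong (2 *_) (sym (∑∑-product xs xs a (λ y → a y ^ m))) ⟩
  2 * ∑[ x ∈ xs ] ∑[ y ∈ xs ] (a x * a y ^ m)
    ≡⟨ sym (∑∑-symmetrise xs (λ x y → a x * a y ^ m)) ⟩
  ∑[ x ∈ xs ] ∑[ y ∈ xs ] (a x * a y ^ m + a y * a x ^ m)
    ≤⟨ ∑-mono-≤ xs (λ x → ∑-mono-≤ xs (λ y → pow-rearrangement (a x) (a y) m)) ⟩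
  ∑[ x ∈ xs ] ∑[ y ∈ xs ] (a x ^ suc m + a y ^ suc m)
    ≡⟨ ∑∑-symmetrise xs (λ x y → a x ^ suc m) ⟩
  2 * ∑[ x ∈ xs ] ∑[ y ∈ xs ] (a x ^ suc m)
    ≡⟨ cong (2 *_) (∑-cong xs (λ x → ∑-const xs (a x ^ suc m))) ⟩
  2 * ∑[ x ∈ xs ] (length xs * a x ^ suc m)
    ≡⟨ cong (2 *_) (sym (*-distribˡ-∑ (length xs) xs (λ x → a x ^ suc m))) ⟩
  2 * (length xs * ∑[ x ∈ xs ] (a x ^ suc m))
    ∎)
  where open ≤-Reasoning

power-mean : ∀ (xs : List A) (a : A → ℕ) j →
             ∑ xs a ^ suc j ≤ length xs ^ j * ∑[ x ∈ xs ] (a x ^ suc j)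
power-mean xs a zero = ≤-reflexive (begin
  ∑ xs a * 1                 ≡⟨ *-identityʳ (∑ xs a) ⟩
  ∑ xs a                     ≡⟨ ∑-cong xs (λ x → sym (*-identityʳ (a x))) ⟩
  ∑[ x ∈ xs ] (a x ^ 1)      ≡⟨ sym (+-identityʳ _) ⟩
  1 * ∑[ x ∈ xs ] (a x ^ 1)  ∎)
  where open ≡-Reasoning
power-mean xs a (suc j) = begin
  S * S ^ suc j                                  ≤⟨ *-monoʳ-≤ S (power-mean xs a j) ⟩
  S * (L ^ j * ∑[ x ∈ xs ] (a x ^ suc j))        ≡⟨ x*[y*z]≡y*[x*z] S (L ^ j) _ ⟩
  L ^ j * (S * ∑[ x ∈ xs ] (a x ^ suc j))        ≤⟨ *-monoʳ-≤ (L ^ j) (chebyshev xs a (suc j)) ⟩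
  L ^ j * (L * ∑[ x ∈ xs ] (a x ^ suc (suc j)))  ≡⟨ x*[y*z]≡y*[x*z] (L ^ j) L _ ⟩
  L * (L ^ j * ∑[ x ∈ xs ] (a x ^ suc (suc j)))  ≡⟨ *-assoc L (L ^ j) _ ⟨
  L ^ suc j * ∑[ x ∈ xs ] (a x ^ suc (suc j))    ∎
  where
  open ≤-Reasoning
  S L : ℕ
  S = ∑ xs a
  L = length xs

∑-allFin-suc : ∀ n (f : Fin (suc n) → ℕ) →
               ∑ (allFin (suc n)) f ≡ f zero + ∑[ i ∈ allFin n ] f (suc i)
∑-allFin-suc n f =
  cong (f zero +_) (trans (cong (λ is → ∑ is f) (sym (map-tabulate id suc))) (∑-map suc (allFin n) f))

count : ∀ {n} → (Fin n → Bool) → ℕ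
count {n} P = ∑ (allFin n) (𝟙 ∘ P)

count-≟ : ∀ n (y : Fin n) → count (λ x → does (x ≟ y)) ≡ 1
count-≟ (suc n) zero = begin
  count {suc n} (λ x → does (x ≟ zero))  ≡⟨ ∑-allFin-suc n (λ x → 𝟙 (does (x ≟ zero))) ⟩
  1 + ∑[ x ∈ allFin n ] 0                ≡⟨ cong suc (∑-zero (allFin n)) ⟩
  1                                      ∎
  where open ≡-Reasoning
count-≟ (suc n) (suc y) = trans (∑-allFin-suc n (λ x → 𝟙 (does (x ≟ suc y)))) (count-≟ n y)

∑-allMaps-suc : ∀ k n (f : Vec (Fin n) (suc k) → ℕ) →
                ∑ (allMaps (suc k) n) f ≡ ∑[ i ∈ allFin n ] ∑[ ψ ∈ allMaps k n ] f (i ∷ ψ)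
∑-allMaps-suc k n f =
  trans (∑-concatMap _ (allFin n) f) (∑-cong (allFin n) (λ i → ∑-map (i ∷_) (allMaps k n) f))

∑-allMaps-insertAt : ∀ {k} n (v : Fin (suc k)) (f : Vec (Fin n) (suc k) → ℕ) →
                     ∑ (allMaps (suc k) n) f ≡ ∑[ ψ ∈ allMaps k n ] ∑[ w ∈ allFin n ] f (insertAt ψ v w)
∑-allMaps-insertAt {k} n zero f =
  trans (∑-allMaps-suc k n f) (∑-comm (allFin n) (allMaps k n) (λ w ψ → f (w ∷ ψ)))
∑-allMaps-insertAt {suc k} n (suc v) f = begin
  ∑ (allMaps (suc (suc k)) n) f
    ≡⟨ ∑-allMaps-suc (suc k) n f ⟩
  ∑[ i ∈ allFin n ] ∑[ φ ∈ allMaps (suc k) n ] f (i ∷ φ)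
    ≡⟨ ∑-cong (allFin n) (λ i → ∑-allMaps-insertAt n v (f ∘ (i ∷_))) ⟩
  ∑[ i ∈ allFin n ] ∑[ ψ ∈ allMaps k n ] ∑[ w ∈ allFin n ] f (i ∷ insertAt ψ v w)
    ≡⟨ sym (∑-allMaps-suc k n (λ ψ → ∑[ w ∈ allFin n ] f (insertAt ψ (suc v) w))) ⟩
  ∑[ ψ ∈ allMaps (suc k) n ] ∑[ w ∈ allFin n ] f (insertAt ψ (suc v) w)
    ∎
  where open ≡-Reasoning

∑-allMaps-++ : ∀ k l n (f : Vec (Fin n) (k + l) → ℕ) →
               ∑ (allMaps (k + l) n) f ≡ ∑[ φ ∈ allMaps k n ] ∑[ χ ∈ allMaps l n ] f (φ ++ χ)
∑-allMaps-++ zero    l n f = sym (+-identityʳ _)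
∑-allMaps-++ (suc k) l n f = begin
  ∑ (allMaps (suc k + l) n) f
    ≡⟨ ∑-allMaps-suc (k + l) n f ⟩
  ∑[ i ∈ allFin n ] ∑[ φ ∈ allMaps (k + l) n ] f (i ∷ φ)
    ≡⟨ ∑-cong (allFin n) (λ i → ∑-allMaps-++ k l n (f ∘ (i ∷_))) ⟩
  ∑[ i ∈ allFin n ] ∑[ φ ∈ allMaps k n ] ∑[ χ ∈ allMaps l n ] f (i ∷ φ ++ χ)
    ≡⟨ sym (∑-allMaps-suc k n (λ φ → ∑[ χ ∈ allMaps l n ] f (φ ++ χ))) ⟩
  ∑[ φ ∈ allMaps (suc k) n ] ∑[ χ ∈ allMaps l n ] f (φ ++ χ)
    ∎
  where open ≡-Reasoning

length-allMaps : ∀ k n → length (allMaps k n) ≡ n ^ k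
length-allMaps zero    n = refl
length-allMaps (suc k) n = begin
  length (allMaps (suc k) n)                   ≡⟨ length≡∑1 (allMaps (suc k) n) ⟩
  ∑[ φ ∈ allMaps (suc k) n ] 1                 ≡⟨ ∑-allMaps-suc k n (λ _ → 1) ⟩
  ∑[ i ∈ allFin n ] ∑[ ψ ∈ allMaps k n ] 1     ≡⟨ ∑-cong (allFin n) (λ _ → sym (length≡∑1 (allMaps k n))) ⟩
  ∑[ i ∈ allFin n ] length (allMaps k n)       ≡⟨ ∑-const (allFin n) _ ⟩
  length (allFin n) * length (allMaps k n)     ≡⟨ cong₂ _*_ (length-tabulate {n = n} id) (length-allMaps k n) ⟩
  n * n ^ k                                    ∎
  where open ≡-Reasoning

_∈ᵇ_ : ∀ {n m} → Fin n → Vec (Fin n) m → Bool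
x ∈ᵇ []      = false
x ∈ᵇ (y ∷ u) = does (x ≟ y) ∨ x ∈ᵇ u

∈ᵇ-lookup : ∀ {n m} (u : Vec (Fin n) m) s → T (lookup u s ∈ᵇ u)
∈ᵇ-lookup (y ∷ u) zero    rewrite dec-true (y ≟ y) refl = _
∈ᵇ-lookup (y ∷ u) (suc s) = Equivalence.from (T-∨ {does (lookup u s ≟ y)}) (inj₂ (∈ᵇ-lookup u s))

count-∈ᵇ : ∀ {n m} (u : Vec (Fin n) m) → count (_∈ᵇ u) ≤ m
count-∈ᵇ {n} []      = ≤-reflexive (∑-zero (allFin n))
count-∈ᵇ {n} {suc m} (y ∷ u) = begin
  count (_∈ᵇ (y ∷ u))
    ≤⟨ ∑-mono-≤ (allFin n) (λ x → 𝟙-∨-≤ (does (x ≟ y)) (x ∈ᵇ u)) ⟩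
  ∑[ x ∈ allFin n ] (𝟙 (does (x ≟ y)) + 𝟙 (x ∈ᵇ u))
    ≡⟨ ∑-distrib-+ (allFin n) _ _ ⟩
  count (λ x → does (x ≟ y)) + count (_∈ᵇ u)
    ≤⟨ +-mono-≤ (≤-reflexive (count-≟ n y)) (count-∈ᵇ u) ⟩
  suc m
    ∎
  where open ≤-Reasoning

count-∖ : ∀ {n m} (P : Fin n → Bool) (u : Vec (Fin n) m) →
          count P ∸ m ≤ count (λ x → P x ∧ not (x ∈ᵇ u))
count-∖ {n} {m} P u = m≤n+o⇒m∸n≤o (count P) m (begin
  count P
    ≤⟨ ∑-mono-≤ (allFin n) (λ x → 𝟙-≤-∧-not (P x) (x ∈ᵇ u)) ⟩
  ∑[ x ∈ allFin n ] (𝟙 (P x ∧ not (x ∈ᵇ u)) + 𝟙 (x ∈ᵇ u))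
    ≡⟨ ∑-distrib-+ (allFin n) _ _ ⟩
  count (λ x → P x ∧ not (x ∈ᵇ u)) + count (_∈ᵇ u)
    ≤⟨ +-monoʳ-≤ _ (count-∈ᵇ u) ⟩
  count (λ x → P x ∧ not (x ∈ᵇ u)) + m
    ≡⟨ +-comm _ m ⟩
  m + count (λ x → P x ∧ not (x ∈ᵇ u))
    ∎)
  where open ≤-Reasoning

distinctIn : ∀ {n m} → (Fin n → Bool) → Vec (Fin n) m → Bool
distinctIn P []      = true
distinctIn P (x ∷ u) = P x ∧ not (x ∈ᵇ u) ∧ distinctIn P u

numDistinctTuples : ∀ {n} → (Fin n → Bool) → ℕ → ℕ
numDistinctTuples {n} P m = ∑[ u ∈ allMaps m n ] 𝟙 (distinctIn P u)

numDistinctTuples-suc : ∀ {n} (P : Fin n → Bool) m →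
                        (count P ∸ m) * numDistinctTuples P m ≤ numDistinctTuples P (suc m)
numDistinctTuples-suc {n} P m = begin
  (count P ∸ m) * numDistinctTuples P m
    ≡⟨ *-distribˡ-∑ (count P ∸ m) (allMaps m n) _ ⟩
  ∑[ u ∈ allMaps m n ] ((count P ∸ m) * 𝟙 (distinctIn P u))
    ≤⟨ ∑-mono-≤ (allMaps m n) (λ u → *-monoˡ-≤ (𝟙 (distinctIn P u)) (count-∖ P u)) ⟩
  ∑[ u ∈ allMaps m n ] (count (fresh u) * 𝟙 (distinctIn P u))
    ≡⟨ ∑-cong (allMaps m n) (λ u → *-distribʳ-∑ (𝟙 (distinctIn P u)) (allFin n) (𝟙 ∘ fresh u)) ⟩
  ∑[ u ∈ allMaps m n ] ∑[ x ∈ allFin n ] (𝟙 (fresh u x) * 𝟙 (distinctIn P u))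
    ≡⟨ ∑-comm (allMaps m n) (allFin n) _ ⟩
  ∑[ x ∈ allFin n ] ∑[ u ∈ allMaps m n ] (𝟙 (fresh u x) * 𝟙 (distinctIn P u))
    ≡⟨ ∑-cong (allFin n) (λ x → ∑-cong (allMaps m n) (λ u → 𝟙-distinctIn-∷ x u)) ⟩
  ∑[ x ∈ allFin n ] ∑[ u ∈ allMaps m n ] 𝟙 (distinctIn P (x ∷ u))
    ≡⟨ sym (∑-allMaps-suc m n (𝟙 ∘ distinctIn P)) ⟩
  numDistinctTuples P (suc m)
    ∎
  where
  open ≤-Reasoning
  fresh : Vec (Fin n) m → Fin n → Bool
  fresh u x = P x ∧ not (x ∈ᵇ u)
  𝟙-distinctIn-∷ : ∀ x u → 𝟙 (fresh u x) * 𝟙 (distinctIn P u) ≡ 𝟙 (distinctIn P (x ∷ u))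
  𝟙-distinctIn-∷ x u = trans (sym (𝟙-∧ (fresh u x) _)) (cong 𝟙 (∧-assoc (P x) _ _))

numDistinctTuples-≥ : ∀ {n} (P : Fin n → Bool) t′ m → m ≤ suc t′ →
                      (count P ∸ t′) ^ m ≤ numDistinctTuples P m
numDistinctTuples-≥ P t′ zero    _           = ≤-refl
numDistinctTuples-≥ P t′ (suc m) (s≤s m≤t′) = ≤-trans
  (*-mono-≤ (∸-monoʳ-≤ (count P) m≤t′) (numDistinctTuples-≥ P t′ m (m≤n⇒m≤1+n m≤t′)))
  (numDistinctTuples-suc P m)

distinctIn-∷⁻ : ∀ {n m} (P : Fin n → Bool) x (u : Vec (Fin n) m) → T (distinctIn P (x ∷ u)) →
                T (P x) × ¬ T (x ∈ᵇ u) × T (distinctIn P u)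
distinctIn-∷⁻ P x u d with Equivalence.to (T-∧ {P x}) d
... | Px , rest with Equivalence.to (T-∧ {not (x ∈ᵇ u)}) rest
...   | x∉u , du = Px , (λ x∈u → subst T (Equivalence.to T-not-≡ x∉u) x∈u) , du

distinctIn-lookup : ∀ {n m} (P : Fin n → Bool) (u : Vec (Fin n) m) → T (distinctIn P u) →
                    ∀ s → T (P (lookup u s))
distinctIn-lookup P (x ∷ u) d s with distinctIn-∷⁻ P x u d
distinctIn-lookup P (x ∷ u) d zero    | Px , _ , _  = Px
distinctIn-lookup P (x ∷ u) d (suc s) | _  , _ , du = distinctIn-lookup P u du s

distinctIn-injective : ∀ {n m} (P : Fin n → Bool) (u : Vec (Fin n) m) → T (distinctIn P u) →
                       ∀ s s′ → lookup u s ≡ lookup u s′ → s ≡ s′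
distinctIn-injective P (x ∷ u) d s s′ eq with distinctIn-∷⁻ P x u d
distinctIn-injective P (x ∷ u) d zero    zero     _  | _ = refl
distinctIn-injective P (x ∷ u) d zero    (suc s′) x≡ | _ , x∉u , _ =
  ⊥-elim (x∉u (subst (λ y → T (y ∈ᵇ u)) (sym x≡) (∈ᵇ-lookup u s′)))
distinctIn-injective P (x ∷ u) d (suc s) zero     ≡x | _ , x∉u , _ =
  ⊥-elim (x∉u (subst (λ y → T (y ∈ᵇ u)) ≡x (∈ᵇ-lookup u s)))
distinctIn-injective P (x ∷ u) d (suc s) (suc s′) eq | _ , _ , du =
  cong suc (distinctIn-injective P u du s s′ eq)

splitAt-injective : ∀ m {n} {i j : Fin (m + n)} → splitAt m i ≡ splitAt m j → i ≡ j
splitAt-injective m {n} {i} {j} eq =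
  trans (sym (join-splitAt m n i)) (trans (cong (join m n) eq) (join-splitAt m n j))

[,]-injective : {f : A → C} {g : B → C} →
                (∀ x y → f x ≡ f y → x ≡ y) → (∀ x y → g x ≡ g y → x ≡ y) → (∀ x y → f x ≢ g y) →
                ∀ s r → [ f , g ]′ s ≡ [ f , g ]′ r → s ≡ r
[,]-injective f-inj g-inj f≢g (inj₁ x) (inj₁ y) eq = cong inj₁ (f-inj x y eq)
[,]-injective f-inj g-inj f≢g (inj₁ x) (inj₂ y) eq = ⊥-elim (f≢g x y eq)
[,]-injective f-inj g-inj f≢g (inj₂ x) (inj₁ y) eq = ⊥-elim (f≢g y x (sym eq))
[,]-injective f-inj g-inj f≢g (inj₂ x) (inj₂ y) eq = cong inj₂ (g-inj x y eq)

lookup-insertAt-≢ : ∀ {k} (ψ : Vec A k) {v i : Fin (suc k)} (v≢i : v ≢ i) x →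
                    lookup (insertAt ψ v x) i ≡ lookup ψ (punchOut v≢i)
lookup-insertAt-≢ ψ {v} v≢i x = trans
  (cong (lookup (insertAt ψ v x)) (sym (punchIn-punchOut v≢i)))
  (insertAt-punchIn ψ v x (punchOut v≢i))

blowUp-copy : ∀ {k′ n} (F : Graph (suc k′)) (v : Fin (suc k′)) (t′ : ℕ) (G : Graph n)
              (ψ : Vec (Fin n) k′) (w : Fin n) (χ : Vec (Fin n) t′) →
              (∀ s → IsOrderedCopy F G (insertAt ψ v (lookup (w ∷ χ) s))) →
              (∀ s r → lookup (w ∷ χ) s ≡ lookup (w ∷ χ) r → s ≡ r) →
              IsOrderedCopy (blowUp F v t′) G (insertAt ψ v w ++ χ)
blowUp-copy {k′} {n} F v t′ G ψ w χ copy distinct = injective , edges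
  where
  φ : Fin (suc t′) → Vec (Fin n) (suc k′)
  φ s = insertAt ψ v (lookup (w ∷ χ) s)

  agree : ∀ s {i} → i ≢ v → lookup (φ zero) i ≡ lookup (φ s) i
  agree s i≢v = trans (lookup-insertAt-≢ ψ (i≢v ∘ sym) w)
                      (sym (lookup-insertAt-≢ ψ (i≢v ∘ sym) _))

  disjoint : ∀ i b → lookup (φ zero) i ≢ lookup χ b
  disjoint i b eq with i ≟ v
  ... | yes refl = 0≢1+n (distinct zero (suc b) (trans (sym (insertAt-lookup ψ v w)) eq))
  ... | no i≢v   = i≢v (proj₁ (copy (suc b)) i v (begin
    lookup (φ (suc b)) i  ≡⟨ sym (agree (suc b) i≢v) ⟩
    lookup (φ zero) i     ≡⟨ eq ⟩
    lookup χ b            ≡⟨ sym (insertAt-lookup ψ v (lookup χ b)) ⟩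
    lookup (φ (suc b)) v  ∎))
    where open ≡-Reasoning

  edge-to-new : ∀ i b → T (adj F i v) → T (adj G (lookup (φ zero) i) (lookup χ b))
  edge-to-new i b h with i ≟ v
  ... | yes refl = ⊥-elim (subst T (loopless F v) h)
  ... | no i≢v   = subst₂ (λ x y → T (adj G x y))
    (sym (agree (suc b) i≢v)) (insertAt-lookup ψ v (lookup χ b)) (proj₂ (copy (suc b)) i v h)

  injective : ∀ i j → lookup (insertAt ψ v w ++ χ) i ≡ lookup (insertAt ψ v w ++ χ) j → i ≡ j
  injective i j eq = splitAt-injective (suc k′)
    ([,]-injective (proj₁ (copy zero)) (λ b b′ → suc-injective ∘ distinct (suc b) (suc b′)) disjoint
      (splitAt (suc k′) i) (splitAt (suc k′) j)
      (trans (sym (lookup-splitAt (suc k′) (φ zero) χ i))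
             (trans eq (lookup-splitAt (suc k′) (φ zero) χ j))))

  edges : ∀ i j → T (adj (blowUp F v t′) i j) →
          T (adj G (lookup (insertAt ψ v w ++ χ) i) (lookup (insertAt ψ v w ++ χ) j))
  edges i j
    rewrite lookup-splitAt (suc k′) (φ zero) χ i | lookup-splitAt (suc k′) (φ zero) χ j
    with splitAt (suc k′) i | splitAt (suc k′) j
  ... | inj₁ a | inj₁ b = proj₂ (copy zero) a b
  ... | inj₁ a | inj₂ b = edge-to-new a b
  ... | inj₂ b | inj₁ a = subst T (Graph.sym G _ _) ∘ edge-to-new a b ∘ subst T (Graph.sym F v a)
  ... | inj₂ _ | inj₂ _ = λ ()

∑-≤-*+∑-∸ : ∀ (xs : List A) (d : A → ℕ) t → ∑ xs d ≤ length xs * t + ∑[ x ∈ xs ] (d x ∸ t)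
∑-≤-*+∑-∸ xs d t = begin
  ∑ xs d                                ≤⟨ ∑-mono-≤ xs (λ x → m≤n+m∸n (d x) t) ⟩
  ∑[ x ∈ xs ] (t + (d x ∸ t))           ≡⟨ ∑-distrib-+ xs (λ _ → t) (λ x → d x ∸ t) ⟩
  ∑[ x ∈ xs ] t + ∑[ x ∈ xs ] (d x ∸ t) ≡⟨ cong (_+ ∑[ x ∈ xs ] (d x ∸ t)) (∑-const xs t) ⟩
  length xs * t + ∑[ x ∈ xs ] (d x ∸ t) ∎
  where open ≤-Reasoning

≤-double-of-margin : ∀ {S m R} → S ≤ m + R → 2 * m ≤ S → S ≤ 2 * R
≤-double-of-margin {S} {m} {R} S≤m+R 2m≤S = +-cancelˡ-≤ S S (2 * R) (begin
  S + S                  ≤⟨ +-mono-≤ S≤m+R S≤m+R ⟩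
  (m + R) + (m + R)      ≡⟨ regroup m R ⟩
  2 * m + 2 * R          ≤⟨ +-monoˡ-≤ (2 * R) 2m≤S ⟩
  S + 2 * R              ∎)
  where
  open ≤-Reasoning
  regroup : ∀ m R → (m + R) + (m + R) ≡ 2 * m + 2 * R
  regroup = solve-∀

^-distribʳ-* : ∀ m n o → (m * n) ^ o ≡ m ^ o * n ^ o
^-distribʳ-* m n zero    = refl
^-distribʳ-* m n (suc o) = trans (cong ((m * n) *_) (^-distribʳ-* m n o)) (shuffle m n (m ^ o) (n ^ o))
  where
  shuffle : ∀ m n x y → m * n * (x * y) ≡ m * x * (n * y)
  shuffle = solve-∀

-- When d averages at least 4t, truncating every value by t − 1 keeps at least half of the total,
-- and the power mean inequality applies to the truncated values.
∑-^-≤-∑-∸-^ : ∀ (xs : List A) (d : A → ℕ) t′ → 4 * suc t′ * length xs ≤ ∑ xs d →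
              ∑ xs d ^ suc t′ * length xs
                ≤ ∑[ x ∈ xs ] ((d x ∸ t′) ^ suc t′) * 2 ^ suc t′ * length xs ^ suc t′
∑-^-≤-∑-∸-^ xs d t′ 4tL≤S = begin
  S ^ t * L                    ≤⟨ *-monoˡ-≤ L (^-monoˡ-≤ t S≤2R) ⟩
  (2 * R) ^ t * L              ≡⟨ cong (_* L) (^-distribʳ-* 2 R t) ⟩
  2 ^ t * R ^ t * L            ≤⟨ *-monoˡ-≤ L (*-monoʳ-≤ (2 ^ t) (power-mean xs (λ x → d x ∸ t′) t′)) ⟩
  2 ^ t * (L ^ t′ * P) * L     ≡⟨ shuffle (2 ^ t) (L ^ t′) P L ⟩
  P * 2 ^ t * (L * L ^ t′)     ∎
  where
  open ≤-Reasoning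
  t L S R P : ℕ
  t = suc t′
  L = length xs
  S = ∑ xs d
  R = ∑[ x ∈ xs ] (d x ∸ t′)
  P = ∑[ x ∈ xs ] ((d x ∸ t′) ^ t)
  2Lt′≤4tL : 2 * (L * t′) ≤ 4 * t * L
  2Lt′≤4tL = subst (2 * (L * t′) ≤_) (sym (split L t′)) (m≤m+n _ _)
    where
    split : ∀ L t′ → 4 * suc t′ * L ≡ 2 * (L * t′) + (2 * L * t′ + 4 * L)
    split = solve-∀
  S≤2R : S ≤ 2 * R
  S≤2R = ≤-double-of-margin {m = L * t′} {R} (∑-≤-*+∑-∸ xs d t′) (≤-trans 2Lt′≤4tL 4tL≤S)
  shuffle : ∀ a b c l → a * (b * c) * l ≡ c * a * (l * b)
  shuffle = solve-∀

module _ {k′ n} (F : Graph (suc k′)) (v : Fin (suc k′)) (G : Graph n) where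

  extendsAt : Vec (Fin n) k′ → Fin n → Bool
  extendsAt ψ w = does (isOrderedCopy? F G (insertAt ψ v w))

  numCopies-by-image-of-v : numCopies F G ≡ ∑[ ψ ∈ allMaps k′ n ] count (extendsAt ψ)
  numCopies-by-image-of-v =
    trans (length-filter (isOrderedCopy? F G) (allMaps (suc k′) n)) (∑-allMaps-insertAt n v _)

  blowUp-copy-of-distinct-extensions : ∀ t′ ψ w (χ : Vec (Fin n) t′) →
    T (distinctIn (extendsAt ψ) (w ∷ χ)) → IsOrderedCopy (blowUp F v t′) G (insertAt ψ v w ++ χ)
  blowUp-copy-of-distinct-extensions t′ ψ w χ d = blowUp-copy F v t′ G ψ w χ
    (λ s → from-T-does (isOrderedCopy? F G (insertAt ψ v (lookup (w ∷ χ) s)))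
                       (distinctIn-lookup (extendsAt ψ) (w ∷ χ) d s))
    (distinctIn-injective (extendsAt ψ) (w ∷ χ) d)

  numCopies-blowUp-≥ : ∀ t′ → ∑[ ψ ∈ allMaps k′ n ] ((count (extendsAt ψ) ∸ t′) ^ suc t′)
                                ≤ numCopies (blowUp F v t′) G
  numCopies-blowUp-≥ t′ = begin
    ∑[ ψ ∈ ψs ] ((count (extendsAt ψ) ∸ t′) ^ suc t′)
      ≤⟨ ∑-mono-≤ ψs (λ ψ → numDistinctTuples-≥ (extendsAt ψ) t′ (suc t′) ≤-refl) ⟩
    ∑[ ψ ∈ ψs ] numDistinctTuples (extendsAt ψ) (suc t′)
      ≡⟨ ∑-cong ψs (λ ψ → ∑-allMaps-suc t′ n (𝟙 ∘ distinctIn (extendsAt ψ))) ⟩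
    ∑[ ψ ∈ ψs ] ∑[ w ∈ allFin n ] ∑[ χ ∈ χs ] 𝟙 (distinctIn (extendsAt ψ) (w ∷ χ))
      ≤⟨ ∑-mono-≤ ψs (λ ψ → ∑-mono-≤ (allFin n) (λ w → ∑-mono-≤ χs (λ χ →
           𝟙-mono (to-T-does (isOrderedCopy? H G (insertAt ψ v w ++ χ))
                   ∘ blowUp-copy-of-distinct-extensions t′ ψ w χ)))) ⟩
    ∑[ ψ ∈ ψs ] ∑[ w ∈ allFin n ] ∑[ χ ∈ χs ] isCopyᴴ (insertAt ψ v w ++ χ)
      ≡⟨ sym (∑-allMaps-insertAt n v (λ φ → ∑[ χ ∈ χs ] isCopyᴴ (φ ++ χ))) ⟩
    ∑[ φ ∈ allMaps (suc k′) n ] ∑[ χ ∈ χs ] isCopyᴴ (φ ++ χ)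
      ≡⟨ sym (∑-allMaps-++ (suc k′) t′ n isCopyᴴ) ⟩
    ∑[ Φ ∈ allMaps (suc k′ + t′) n ] isCopyᴴ Φ
      ≡⟨ sym (length-filter (isOrderedCopy? H G) (allMaps (suc k′ + t′) n)) ⟩
    numCopies H G
      ∎
    where
    open ≤-Reasoning
    ψs : List (Vec (Fin n) k′)
    ψs = allMaps k′ n
    χs : List (Vec (Fin n) t′)
    χs = allMaps t′ n
    H : Graph (suc k′ + t′)
    H = blowUp F v t′
    isCopyᴴ : Vec (Fin n) (suc k′ + t′) → ℕ
    isCopyᴴ Φ = 𝟙 (does (isOrderedCopy? H G Φ))

lemma2p2 : (k' : ℕ) (F : Graph (suc k')) (v : Fin (suc k')) (t' : ℕ)
           (n : ℕ) (G : Graph n) →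
           4 * suc t' * n ^ k' ≤ numCopies F G →
           numCopies F G ^ suc t' * n ^ k'
             ≤ numCopies (blowUp F v t') G * 2 ^ suc t' * n ^ (suc t' * k')
lemma2p2 k′ F v t′ n G 4tM≤c = begin
  numCopies F G ^ suc t′ * n ^ k′
    ≡⟨ cong₂ (λ c M → c ^ suc t′ * M) c≡∑d (sym L≡M) ⟩
  ∑ ψs d ^ suc t′ * length ψs
    ≤⟨ ∑-^-≤-∑-∸-^ ψs d t′ (subst₂ (λ M c → 4 * suc t′ * M ≤ c) (sym L≡M) c≡∑d 4tM≤c) ⟩
  ∑[ ψ ∈ ψs ] ((d ψ ∸ t′) ^ suc t′) * 2 ^ suc t′ * length ψs ^ suc t′
    ≤⟨ *-monoˡ-≤ (length ψs ^ suc t′) (*-monoˡ-≤ (2 ^ suc t′) (numCopies-blowUp-≥ F v G t′)) ⟩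
  numCopies (blowUp F v t′) G * 2 ^ suc t′ * length ψs ^ suc t′
    ≡⟨ cong (numCopies (blowUp F v t′) G * 2 ^ suc t′ *_) Lᵗ≡ ⟩
  numCopies (blowUp F v t′) G * 2 ^ suc t′ * n ^ (suc t′ * k′)
    ∎
  where
  open ≤-Reasoning
  ψs : List (Vec (Fin n) k′)
  ψs = allMaps k′ n
  d : Vec (Fin n) k′ → ℕ
  d = count ∘ extendsAt F v G
  c≡∑d : numCopies F G ≡ ∑ ψs d
  c≡∑d = numCopies-by-image-of-v F v G
  L≡M : length ψs ≡ n ^ k′
  L≡M = length-allMaps k′ n
  Lᵗ≡ : length ψs ^ suc t′ ≡ n ^ (suc t′ * k′)
  Lᵗ≡ = trans (cong (_^ suc t′) L≡M)
              (trans (^-*-assoc n k′ (suc t′)) (cong (n ^_) (*-comm k′ (suc t′))))
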